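{- Let $d\ge 1$ and let $\maltese_d$ be the star graph with a central vertex $0$ of degree $d$ joined to $d$ vertices $1,\dots,d$ (the petals), each of degree $1$. Then the equivalence classes of labelings of $\maltese_d$ are: (1) the class consisting only of the zero labeling; (2) for every $m$ with $0<2m\le d$, each of the $\binom{d}{2m}$ labelings in which the central vertex is labeled $0$ and exactly $2m$ petals are labeled $1$ is a fixed labeling (a class by itself); (3) one class consisting of all labelings with an odd number of components, represented by the labeling with the central vertex labeled $1$ and all petals labeled $0$. In particular the number of classes is $1+\binom{d}{2}+\binom{d}{4}+\dots+\binom{d}{2\lfloor d/2\rfloor}+1=2^{d-1}+1$.
   Context: Reeder's puzzle on a finite connected simple graph $D$: a labeling is a vector $a=(a_i)$ with $a_i\in\mathbb{Z}/2\mathbb{Z}$ for each vertex $i$. The move $T_i$ sends $a$ to $a'$ with $a'_j=a_j$ for $j\neq i$ and $a'_i=a_i+\sum_k a_k \pmod 2$, summing over the neighbors $k$ of $i$. Two labelings are equivalent if one is obtained from the other by a finite sequence of moves. A labeling is fixed if $T_i(a)=a$ for all $i$. The components of a labeling are the connected components of the subgraph induced on the vertices labeled $1$. -}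

module Defs where

open import Data.Bool using (Bool; true; false; _∧_; _∨_; _xor_; not; if_then_else_)
open import Data.Nat using (ℕ; zero; suc; _+_; _<ᵇ_)
open import Data.Fin using (Fin; zero; suc; toℕ)
open import Data.List as List using (List; allFin; foldr; map)
open import Data.Bool.ListAction using (any)
open import Data.Vec as Vec using (Vec; lookup; _[_]≔_; replicate; head; tail; _∷_)
open import Data.Product using (∃)
open import Relation.Binary.PropositionalEquality using (_≡_)
open import Relation.Binary.Construct.Closure.ReflexiveTransitive using (Star)

Adj : ℕ → Set
Adj n = Fin n → Fin n → Bool

-- Labelings: one element of ℤ/2ℤ (encoded as Bool, addition = xor) per vertex.
Labeling : ℕ → Set
Labeling n = Vec Bool n

nbrSum : ∀ {n} → Adj n → Labeling n → Fin n → Bool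
nbrSum {n} adj a i = foldr _xor_ false (map (λ k → adj i k ∧ lookup a k) (allFin n))

move : ∀ {n} → Adj n → Fin n → Labeling n → Labeling n
move adj i a = a [ i ]≔ (lookup a i xor nbrSum adj a i)

Step : ∀ {n} → Adj n → Labeling n → Labeling n → Set
Step adj a b = ∃ λ i → move adj i a ≡ b

Equiv : ∀ {n} → Adj n → Labeling n → Labeling n → Set
Equiv adj = Star (Step adj)

Fixed : ∀ {n} → Adj n → Labeling n → Set
Fixed {n} adj a = (i : Fin n) → move adj i a ≡ a

zeroLabeling : ∀ n → Labeling n
zeroLabeling n = replicate n false

anyFin : ∀ n → (Fin n → Bool) → Bool
anyFin n f = any f (allFin n)

-- reach adj a k i j : j is reachable from i by a walk of length ≤ k inside
-- the induced subgraph on vertices labelled 1 (i itself must be labelled 1).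
reach : ∀ {n} → Adj n → Labeling n → ℕ → Fin n → Fin n → Bool
reach {n} adj a zero    i j = lookup a i ∧ (toℕ i Data.Nat.≡ᵇ toℕ j)
reach {n} adj a (suc k) i j =
  reach adj a k i j ∨ anyFin n (λ m → reach adj a k i m ∧ adj m j ∧ lookup a j)

-- i and j lie in the same component (walks of length < n suffice)
sameComp : ∀ {n} → Adj n → Labeling n → Fin n → Fin n → Bool
sameComp {n} adj a i j = reach adj a n i j

isRep : ∀ {n} → Adj n → Labeling n → Fin n → Bool
isRep {n} adj a i =
  lookup a i ∧ not (anyFin n (λ j → (toℕ j <ᵇ toℕ i) ∧ sameComp adj a i j))

countTrue : List Bool → ℕ
countTrue = foldr (λ b r → if b then suc r else r) 0

-- number of components = number of component representatives
components : ∀ {n} → Adj n → Labeling n → ℕ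
components {n} adj a = countTrue (map (isRep adj a) (allFin n))

starAdj : ∀ d → Adj (suc d)
starAdj d zero    zero    = false
starAdj d zero    (suc _) = true
starAdj d (suc _) zero    = true
starAdj d (suc _) (suc _) = false

centreLabeling : ∀ d → Labeling (suc d)
centreLabeling d = true ∷ replicate d false

petalOnes : ∀ {d} → Labeling (suc d) → ℕ
petalOnes a = countTrue (Vec.toList (tail a))

-- On the star the centre move adds the parity of the petals to the centre,
-- and a petal move adds the centre label to that petal. Hence a labeling with
-- unlit centre and an even number of lit petals is fixed, while "the centre is
-- lit or an odd number of petals is lit" is invariant under moves; the labelings
-- with this property form one class, since once the centre is lit every petal
-- can be toggled independently. They are exactly the labelings with an odd
-- number of components: a lit centre gives a single component, an unlit centre
-- one component per lit petal.

module Submission where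

open import Defs
open import Data.Bool using (Bool; true; false; T; not; _∧_; _∨_; _xor_; if_then_else_)
open import Data.Bool.Properties using (T-∧; T-∨; T-≡; ∧-identityʳ; ∧-zeroʳ; xor-identityʳ; xor-comm; true-xor; not-involutive)
open import Data.Empty using (⊥; ⊥-elim)
open import Data.Fin using (Fin; zero; suc; toℕ)
open import Data.Fin.Properties using (toℕ-injective)
open import Data.List using (List; []; _∷_; _++_; length; allFin; tabulate; foldr; map)
open import Data.List.Properties using (map-tabulate; tabulate-cong; length-++; length-map)
open import Data.List.Membership.Propositional using (_∈_; lose)
open import Data.List.Membership.Propositional.Properties using (∈-allFin; ∈-map⁺; ∈-map⁻; ∈-++⁺ˡ; ∈-++⁺ʳ)
open import Data.List.Relation.Unary.All as All using (All; []; _∷_)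
import Data.List.Relation.Unary.All.Properties as All
open import Data.List.Relation.Unary.Any as Any using (Any; here; there; satisfied)
import Data.List.Relation.Unary.Any.Properties as Any
open import Data.List.Relation.Unary.AllPairs using (AllPairs; []; _∷_)
open import Data.List.Relation.Unary.Unique.Propositional using (Unique)
import Data.List.Relation.Unary.Unique.Propositional.Properties as Unique
open import Data.Nat using (ℕ; zero; suc; _+_; _∸_; _^_; _≤_; _<_; _<ᵇ_; s≤s; z≤n)
open import Data.Nat.Properties using (≡ᵇ⇒≡; ≡⇒≡ᵇ; <⇒<ᵇ; <ᵇ⇒<; <-irrefl; +-comm; +-identityʳ)
open import Data.Nat.DivMod using (_%_; %-distribˡ-+)
open import Data.Product using (_×_; Σ; ∃; _,_; proj₁; proj₂; uncurry)
open import Data.Sum using (inj₁; inj₂)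
open import Data.Vec using (Vec; []; _∷_; lookup; _[_]≔_; replicate; head; tail; toList)
open import Data.Vec.Properties using ([]≔-lookup; ∷-injectiveʳ)
open import Function.Bundles using (_⇔_; mk⇔; Equivalence)
open import Relation.Binary.Core using (Rel)
open import Relation.Binary.Construct.Closure.ReflexiveTransitive using (Star; ε; _◅_; _◅◅_; gmap; fold)
open import Relation.Binary.PropositionalEquality
open import Relation.Nullary using (¬_)

open Equivalence using (to; from)

parity : List Bool → Bool
parity = foldr _xor_ false

bit : Bool → ℕ
bit b = if b then 1 else 0

bit-injective : ∀ {b c} → bit b ≡ bit c → b ≡ c
bit-injective {false} {false} _ = refl
bit-injective {true}  {true}  _ = refl

parity-allFalse : ∀ n → parity (tabulate {n = n} (λ _ → false)) ≡ false
parity-allFalse zero    = refl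
parity-allFalse (suc n) = parity-allFalse n

parity-replicate-false : ∀ n → parity (toList (replicate n false)) ≡ false
parity-replicate-false zero    = refl
parity-replicate-false (suc n) = parity-replicate-false n

countTrue-allFalse : ∀ n → countTrue (tabulate {n = n} (λ _ → false)) ≡ 0
countTrue-allFalse zero    = refl
countTrue-allFalse (suc n) = countTrue-allFalse n

%2-suc : ∀ n b → n % 2 ≡ bit b → suc n % 2 ≡ bit (not b)
%2-suc n b eq = begin
  (1 + n) % 2           ≡⟨ %-distribˡ-+ 1 n 2 ⟩
  (1 + n % 2) % 2       ≡⟨ cong (λ r → (1 + r) % 2) eq ⟩
  (1 + bit b) % 2       ≡⟨ lemma b ⟩
  bit (not b)           ∎
  where
  open ≡-Reasoning
  lemma : ∀ b → (1 + bit b) % 2 ≡ bit (not b)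
  lemma false = refl
  lemma true  = refl

countTrue-%2 : ∀ bs → countTrue bs % 2 ≡ bit (parity bs)
countTrue-%2 []           = refl
countTrue-%2 (false ∷ bs) = countTrue-%2 bs
countTrue-%2 (true ∷ bs)  = %2-suc (countTrue bs) (parity bs) (countTrue-%2 bs)

toList-tabulate-lookup : ∀ {n} (p : Vec Bool n) → tabulate (lookup p) ≡ toList p
toList-tabulate-lookup []      = refl
toList-tabulate-lookup (x ∷ p) = cong (x ∷_) (toList-tabulate-lookup p)

anyFin-intro : ∀ {n} (f : Fin n → Bool) j → T (f j) → T (anyFin n f)
anyFin-intro f j fj = Any.any⁺ f (lose (∈-allFin j) fj)

anyFin-witness : ∀ {n} (f : Fin n → Bool) → T (anyFin n f) → ∃ λ j → T (f j)
anyFin-witness {n} f h = satisfied (Any.any⁻ f (allFin n) h)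

¬T⇒≡false : ∀ {b} → ¬ T b → b ≡ false
¬T⇒≡false {false} _   = refl
¬T⇒≡false {true}  ¬tt = ⊥-elim (¬tt _)

Equiv-invariant : ∀ {n} {adj : Adj n} (Q : Labeling n → Set) →
  (∀ {a b} → Step adj a b → Q a → Q b) → ∀ {a b} → Equiv adj a b → Q a → Q b
Equiv-invariant Q step = fold (λ a b → Q a → Q b) (λ s k q → k (step s q)) (λ q → q)

Fixed⇒Equiv-trivial : ∀ {n} {adj : Adj n} {a b} → Fixed adj a → Equiv adj a b → b ≡ a
Fixed⇒Equiv-trivial {a = a} fixed a~b =
  Equiv-invariant (_≡ a) (λ { (i , refl) refl → fixed i }) a~b refl

Fixed-distinct⇒inequivalent : ∀ {n} {adj : Adj n} {as} → All (Fixed adj) as → Unique as →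
  AllPairs (λ a b → ¬ Equiv adj a b) as
Fixed-distinct⇒inequivalent []                 []                = []
Fixed-distinct⇒inequivalent (fixed ∷ fixeds) (a∉as ∷ unique) =
  All.map (λ a≢b a~b → a≢b (sym (Fixed⇒Equiv-trivial fixed a~b))) a∉as
  ∷ Fixed-distinct⇒inequivalent fixeds unique

components≡countTrue : ∀ {n} (adj : Adj n) a → components adj a ≡ countTrue (tabulate (isRep adj a))
components≡countTrue adj a = cong countTrue (map-tabulate (λ i → i) (isRep adj a))

reach-refl : ∀ {n} (adj : Adj n) a k {i} → T (lookup a i) → T (reach adj a k i i)
reach-refl adj a zero    {i} lit = from T-∧ (lit , ≡⇒≡ᵇ (toℕ i) (toℕ i) refl)
reach-refl adj a (suc k) lit = from T-∨ (inj₁ (reach-refl adj a k lit))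

reach-step : ∀ {n} (adj : Adj n) a k {i m j} → T (reach adj a k i m) → T (adj m j) → T (lookup a j) →
  T (reach adj a (suc k) i j)
reach-step adj a k {m = m} i~m m-j lit =
  from T-∨ (inj₂ (anyFin-intro _ m (from T-∧ (i~m , from T-∧ (m-j , lit)))))

reach-isolated : ∀ {n} (adj : Adj n) a k {i j} → (∀ l → T (adj i l) → T (lookup a l) → ⊥) →
  T (reach adj a k i j) → j ≡ i
reach-isolated adj a zero    {i} {j} _ i~j =
  toℕ-injective (sym (≡ᵇ⇒≡ (toℕ i) (toℕ j) (proj₂ (to T-∧ i~j))))
reach-isolated {n} adj a (suc k) {i} {j} isolated i~j with to T-∨ i~j
... | inj₁ i~j′ = reach-isolated adj a k isolated i~j′
... | inj₂ viaNeighbour with anyFin-witness (λ m → reach adj a k i m ∧ adj m j ∧ lookup a j) viaNeighbour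
...   | m , i~m∧m-j with to T-∧ i~m∧m-j
...     | i~m , m-j with reach-isolated adj a k {j = m} isolated i~m
...       | refl = ⊥-elim (uncurry (isolated j) (to T-∧ m-j))

isRep-unlabelled : ∀ {n} (adj : Adj n) a i → lookup a i ≡ false → isRep adj a i ≡ false
isRep-unlabelled adj a i unlit rewrite unlit = refl

isRep-smaller : ∀ {n} (adj : Adj n) a {i} j → T (sameComp adj a i j) → toℕ j < toℕ i → isRep adj a i ≡ false
isRep-smaller adj a {i} j i~j j<i = trans
  (cong (λ b → lookup a i ∧ not b) (to T-≡ (anyFin-intro _ j (from T-∧ (<⇒<ᵇ j<i , i~j)))))
  (∧-zeroʳ (lookup a i))

isRep-minimal : ∀ {n} (adj : Adj n) a i → (∀ j → T (sameComp adj a i j) → toℕ j < toℕ i → ⊥) →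
  isRep adj a i ≡ lookup a i
isRep-minimal {n} adj a i minimal = trans
  (cong (λ b → lookup a i ∧ not b) (¬T⇒≡false noSmaller))
  (∧-identityʳ (lookup a i))
  where
  noSmaller : ¬ T (anyFin n (λ j → (toℕ j <ᵇ toℕ i) ∧ sameComp adj a i j))
  noSmaller h with anyFin-witness (λ j → (toℕ j <ᵇ toℕ i) ∧ sameComp adj a i j) h
  ... | j , j<i∧i~j = minimal j (proj₂ (to T-∧ j<i∧i~j)) (<ᵇ⇒< _ _ (proj₁ (to T-∧ j<i∧i~j)))

nbrSum-centre : ∀ d c (p : Vec Bool d) → nbrSum (starAdj d) (c ∷ p) zero ≡ parity (toList p)
nbrSum-centre d c p =
  cong parity (trans (map-tabulate suc (λ k → starAdj d zero k ∧ lookup (c ∷ p) k)) (toList-tabulate-lookup p))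

nbrSum-petal : ∀ d c (p : Vec Bool d) i → nbrSum (starAdj d) (c ∷ p) (suc i) ≡ c
nbrSum-petal d c p i = begin
  c xor parity (map (λ k → starAdj d (suc i) k ∧ lookup (c ∷ p) k) (tabulate suc))
    ≡⟨ cong (λ bs → c xor parity bs) (map-tabulate suc (λ k → starAdj d (suc i) k ∧ lookup (c ∷ p) k)) ⟩
  c xor parity (tabulate {n = d} (λ _ → false))
    ≡⟨ cong (c xor_) (parity-allFalse d) ⟩
  c xor false
    ≡⟨ xor-identityʳ c ⟩
  c ∎
  where open ≡-Reasoning

move-centre : ∀ d c (p : Vec Bool d) → move (starAdj d) zero (c ∷ p) ≡ (c xor parity (toList p)) ∷ p
move-centre d c p = cong (λ s → (c xor s) ∷ p) (nbrSum-centre d c p)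

move-petal : ∀ d c (p : Vec Bool d) i → move (starAdj d) (suc i) (c ∷ p) ≡ c ∷ (p [ i ]≔ (lookup p i xor c))
move-petal d c p i = cong (λ s → c ∷ (p [ i ]≔ (lookup p i xor s))) (nbrSum-petal d c p i)

move-petal-unlit : ∀ d (p : Vec Bool d) i → move (starAdj d) (suc i) (false ∷ p) ≡ false ∷ p
move-petal-unlit d p i = begin
  move (starAdj d) (suc i) (false ∷ p)  ≡⟨ move-petal d false p i ⟩
  false ∷ (p [ i ]≔ (lookup p i xor false)) ≡⟨ cong (λ v → false ∷ (p [ i ]≔ v)) (xor-identityʳ (lookup p i)) ⟩
  false ∷ (p [ i ]≔ lookup p i)          ≡⟨ cong (false ∷_) ([]≔-lookup p i) ⟩
  false ∷ p                               ∎
  where open ≡-Reasoning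

move-petal-lit : ∀ d (p : Vec Bool d) i → move (starAdj d) (suc i) (true ∷ p) ≡ true ∷ (p [ i ]≔ not (lookup p i))
move-petal-lit d p i = trans (move-petal d true p i)
  (cong (λ v → true ∷ (p [ i ]≔ v)) (trans (xor-comm (lookup p i) true) (true-xor (lookup p i))))

Fixed-unlit-even : ∀ d (p : Vec Bool d) → parity (toList p) ≡ false → Fixed (starAdj d) (false ∷ p)
Fixed-unlit-even d p even zero    = trans (move-centre d false p) (cong (_∷ p) even)
Fixed-unlit-even d p even (suc i) = move-petal-unlit d p i

centreClass : ∀ {d} → Labeling (suc d) → Bool
centreClass (c ∷ p) = c ∨ parity (toList p)

Step-preserves-centreClass : ∀ {d} {a b : Labeling (suc d)} → Step (starAdj d) a b →
  centreClass a ≡ true → centreClass b ≡ true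
Step-preserves-centreClass {d} {c ∷ p} (zero , refl) inClass =
  subst (λ x → centreClass x ≡ true) (sym (move-centre d c p)) (xor-∨ c (parity (toList p)) inClass)
  where
  xor-∨ : ∀ c s → c ∨ s ≡ true → (c xor s) ∨ s ≡ true
  xor-∨ true  true  _ = refl
  xor-∨ true  false _ = refl
  xor-∨ false true  _ = refl
Step-preserves-centreClass {d} {true ∷ p} (suc i , refl) _ =
  subst (λ x → centreClass x ≡ true) (sym (move-petal-lit d p i)) refl
Step-preserves-centreClass {d} {false ∷ p} (suc i , refl) inClass =
  subst (λ x → centreClass x ≡ true) (sym (move-petal-unlit d p i)) inClass

Flip : ∀ {n} → Rel (Vec Bool n) _
Flip q q′ = ∃ λ i → q [ i ]≔ not (lookup q i) ≡ q′

Flip-connected : ∀ {n} (q p : Vec Bool n) → Star Flip q p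
Flip-connected []      []      = ε
Flip-connected (x ∷ q) (y ∷ p) = flipHead x y ◅◅ gmap (y ∷_) (λ { (i , eq) → suc i , cong (y ∷_) eq }) (Flip-connected q p)
  where
  flipHead : ∀ x y → Star Flip (x ∷ q) (y ∷ q)
  flipHead true  true  = ε
  flipHead false false = ε
  flipHead true  false = (zero , refl) ◅ ε
  flipHead false true  = (zero , refl) ◅ ε

Flips⇒Equiv-lit : ∀ {d} {q p : Vec Bool d} → Star Flip q p → Equiv (starAdj d) (true ∷ q) (true ∷ p)
Flips⇒Equiv-lit {d} = gmap (true ∷_) λ { {q} (i , eq) → suc i , trans (move-petal-lit d q i) (cong (true ∷_) eq) }

light-centre : ∀ {d} (a : Labeling (suc d)) → centreClass a ≡ true → Equiv (starAdj d) a (true ∷ tail a)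
light-centre       (true ∷ p)  _   = ε
light-centre {d} (false ∷ p) odd = (zero , trans (move-centre d false p) (cong (_∷ p) odd)) ◅ ε

unlight-centre : ∀ {d} (a : Labeling (suc d)) → centreClass a ≡ true → Equiv (starAdj d) (true ∷ tail a) a
unlight-centre       (true ∷ p)  _   = ε
unlight-centre {d} (false ∷ p) odd = (zero , trans (move-centre d true p) (cong (λ s → not s ∷ p) odd)) ◅ ε

centreClass-invariant : ∀ {d} {a b : Labeling (suc d)} → Equiv (starAdj d) a b →
  centreClass a ≡ true → centreClass b ≡ true
centreClass-invariant {d} = Equiv-invariant {adj = starAdj d} _ Step-preserves-centreClass

centreClass-connected : ∀ {d} (a b : Labeling (suc d)) → centreClass a ≡ true → centreClass b ≡ true →
  Equiv (starAdj d) a b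
centreClass-connected a b inA inB =
  light-centre a inA ◅◅ Flips⇒Equiv-lit (Flip-connected (tail a) (tail b)) ◅◅ unlight-centre b inB

isRep-lit-centre : ∀ {d} (p : Vec Bool d) → isRep (starAdj d) (true ∷ p) zero ≡ true
isRep-lit-centre {d} p = isRep-minimal (starAdj d) (true ∷ p) zero (λ _ _ ())

isRep-lit-petal : ∀ {d} (p : Vec Bool d) i → isRep (starAdj d) (true ∷ p) (suc i) ≡ false
isRep-lit-petal {d} p i = byPetal (lookup p i) refl
  where
  byPetal : ∀ b → lookup p i ≡ b → isRep (starAdj d) (true ∷ p) (suc i) ≡ false
  byPetal false unlit = isRep-unlabelled (starAdj d) (true ∷ p) (suc i) unlit
  byPetal true  lit   = isRep-smaller (starAdj d) (true ∷ p) zero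
    (reach-step (starAdj d) (true ∷ p) d (reach-refl (starAdj d) (true ∷ p) d (subst T (sym lit) _)) _ _)
    (s≤s z≤n)

isRep-unlit : ∀ {d} (p : Vec Bool d) i → isRep (starAdj d) (false ∷ p) i ≡ lookup (false ∷ p) i
isRep-unlit {d} p zero    = isRep-minimal (starAdj d) (false ∷ p) zero (λ _ _ ())
isRep-unlit {d} p (suc i) = isRep-minimal (starAdj d) (false ∷ p) (suc i) λ j i~j j<i →
  <-irrefl (cong toℕ (reach-isolated (starAdj d) (false ∷ p) (suc d) petalIsolated i~j)) j<i
  where
  petalIsolated : ∀ l → T (starAdj d (suc i) l) → T (lookup (false ∷ p) l) → ⊥
  petalIsolated zero    _ ()
  petalIsolated (suc _) ()

components-lit : ∀ {d} (p : Vec Bool d) → components (starAdj d) (true ∷ p) ≡ 1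
components-lit {d} p = begin
  components (starAdj d) (true ∷ p)
    ≡⟨ components≡countTrue (starAdj d) (true ∷ p) ⟩
  countTrue (isRep (starAdj d) (true ∷ p) zero ∷ tabulate (λ i → isRep (starAdj d) (true ∷ p) (suc i)))
    ≡⟨ cong₂ (λ b bs → countTrue (b ∷ bs)) (isRep-lit-centre p) (tabulate-cong (isRep-lit-petal p)) ⟩
  suc (countTrue (tabulate {n = d} (λ _ → false)))
    ≡⟨ cong suc (countTrue-allFalse d) ⟩
  1 ∎
  where open ≡-Reasoning

components-unlit : ∀ {d} (p : Vec Bool d) → components (starAdj d) (false ∷ p) ≡ countTrue (toList p)
components-unlit {d} p = begin
  components (starAdj d) (false ∷ p)                  ≡⟨ components≡countTrue (starAdj d) (false ∷ p) ⟩
  countTrue (tabulate (isRep (starAdj d) (false ∷ p))) ≡⟨ cong countTrue (tabulate-cong (isRep-unlit p)) ⟩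
  countTrue (tabulate (lookup (false ∷ p)))            ≡⟨ cong countTrue (toList-tabulate-lookup (false ∷ p)) ⟩
  countTrue (toList p)                                 ∎
  where open ≡-Reasoning

components-%2 : ∀ {d} (a : Labeling (suc d)) → components (starAdj d) a % 2 ≡ bit (centreClass a)
components-%2 (true ∷ p)  = cong (_% 2) (components-lit p)
components-%2 (false ∷ p) = trans (cong (_% 2) (components-unlit p)) (countTrue-%2 (toList p))

-- The successor clause comes first so that parityVecs b (suc d) computes for a variable b.
parityVecs : Bool → (d : ℕ) → List (Vec Bool d)
parityVecs b     (suc d) = map (false ∷_) (parityVecs b d) ++ map (true ∷_) (parityVecs (not b) d)
parityVecs false zero    = [] ∷ []
parityVecs true  zero    = []

parityVecs-sound : ∀ b d → All (λ p → parity (toList p) ≡ b) (parityVecs b d)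
parityVecs-sound false zero    = refl ∷ []
parityVecs-sound true  zero    = []
parityVecs-sound b     (suc d) = All.++⁺
  (All.map⁺ (parityVecs-sound b d))
  (All.map⁺ (All.map (λ odd → trans (cong not odd) (not-involutive b)) (parityVecs-sound (not b) d)))

parityVecs-complete : ∀ {d} (p : Vec Bool d) → p ∈ parityVecs (parity (toList p)) d
parityVecs-complete []          = here refl
parityVecs-complete (false ∷ p) = ∈-++⁺ˡ (∈-map⁺ (false ∷_) (parityVecs-complete p))
parityVecs-complete {suc d} (true ∷ p) = ∈-++⁺ʳ (map (false ∷_) (parityVecs (not (parity (toList p))) d))
  (∈-map⁺ (true ∷_) (subst (λ b → p ∈ parityVecs b d) (sym (not-involutive _)) (parityVecs-complete p)))

parityVecs-unique : ∀ b d → Unique (parityVecs b d)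
parityVecs-unique false zero    = [] ∷ []
parityVecs-unique true  zero    = []
parityVecs-unique b     (suc d) = Unique.++⁺
  (Unique.map⁺ ∷-injectiveʳ (parityVecs-unique b d))
  (Unique.map⁺ ∷-injectiveʳ (parityVecs-unique (not b) d))
  disjoint
  where
  disjoint : ∀ {v} → ¬ (v ∈ map (false ∷_) (parityVecs b d) × v ∈ map (true ∷_) (parityVecs (not b) d))
  disjoint (v∈xs , v∈ys) with ∈-map⁻ (false ∷_) v∈xs | ∈-map⁻ (true ∷_) v∈ys
  ... | _ , _ , refl | _ , _ , ()

length-parityVecs : ∀ b d → length (parityVecs b (suc d)) ≡ 2 ^ d
length-parityVecs false zero    = refl
length-parityVecs true  zero    = refl
length-parityVecs b     (suc d) = begin
  length (map (false ∷_) (parityVecs b (suc d)) ++ map (true ∷_) (parityVecs (not b) (suc d)))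
    ≡⟨ length-++ (map (false ∷_) (parityVecs b (suc d))) ⟩
  length (map (false ∷_) (parityVecs b (suc d))) + length (map (true ∷_) (parityVecs (not b) (suc d)))
    ≡⟨ cong₂ _+_ (length-map (false ∷_) (parityVecs b (suc d))) (length-map (true ∷_) (parityVecs (not b) (suc d))) ⟩
  length (parityVecs b (suc d)) + length (parityVecs (not b) (suc d))
    ≡⟨ cong₂ _+_ (length-parityVecs b d) (length-parityVecs (not b) d) ⟩
  2 ^ d + 2 ^ d
    ≡⟨ cong (2 ^ d +_) (sym (+-identityʳ (2 ^ d))) ⟩
  2 ^ suc d ∎
  where open ≡-Reasoning

representatives : ∀ d → List (Labeling (suc d))
representatives d = centreLabeling d ∷ map (false ∷_) (parityVecs false d)

length-representatives : ∀ d → length (representatives (suc d)) ≡ 2 ^ d + 1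
length-representatives d = trans
  (cong suc (trans (length-map (false ∷_) (parityVecs false (suc d))) (length-parityVecs false d)))
  (+-comm 1 (2 ^ d))

representatives-inequivalent : ∀ d → AllPairs (λ a b → ¬ Equiv (starAdj d) a b) (representatives d)
representatives-inequivalent d =
  All.map⁺ (All.map (λ even c~p → false≢true (trans (sym even) (centreClass-invariant c~p refl))) evens)
  ∷ Fixed-distinct⇒inequivalent {adj = starAdj d} (All.map⁺ (All.map (Fixed-unlit-even d _) evens))
                                (Unique.map⁺ ∷-injectiveʳ (parityVecs-unique false d))
  where
  evens = parityVecs-sound false d
  false≢true : false ≢ true
  false≢true ()

representatives-cover : ∀ d (a : Labeling (suc d)) → Any (Equiv (starAdj d) a) (representatives d)
representatives-cover d (true ∷ p) = here (centreClass-connected (true ∷ p) (centreLabeling d) refl refl)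
representatives-cover d (false ∷ p) with parity (toList p) in parityP
... | true  = here (centreClass-connected (false ∷ p) (centreLabeling d) parityP refl)
... | false = there (Any.map⁺ (Any.map (λ { refl → ε })
                (subst (λ b → p ∈ parityVecs b d) parityP (parityVecs-complete p))))

Equiv-centre⇔components-odd : ∀ d (b : Labeling (suc d)) →
  Equiv (starAdj d) (centreLabeling d) b ⇔ (components (starAdj d) b % 2 ≡ 1)
Equiv-centre⇔components-odd d b = mk⇔
  (λ c~b → trans (components-%2 b) (cong bit (centreClass-invariant c~b refl)))
  (λ odd → centreClass-connected (centreLabeling d) b refl (bit-injective (trans (sym (components-%2 b)) odd)))

unlit-even⇒singleton-class : ∀ d (p : Vec Bool d) → countTrue (toList p) % 2 ≡ 0 →
  Fixed (starAdj d) (false ∷ p) × ((b : Labeling (suc d)) → Equiv (starAdj d) (false ∷ p) b → b ≡ false ∷ p)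
unlit-even⇒singleton-class d p even = fixed , λ _ → Fixed⇒Equiv-trivial {adj = starAdj d} fixed
  where
  fixed = Fixed-unlit-even d p (bit-injective (trans (sym (countTrue-%2 (toList p))) even))

theorem3p15 : (d : ℕ) → 1 ≤ d →
    ((a : Labeling (suc d)) → Equiv (starAdj d) (zeroLabeling (suc d)) a → a ≡ zeroLabeling (suc d))
    × ((a : Labeling (suc d)) → head a ≡ false → 0 < petalOnes a → petalOnes a % 2 ≡ 0 →
         Fixed (starAdj d) a × ((b : Labeling (suc d)) → Equiv (starAdj d) a b → b ≡ a))
    × ((b : Labeling (suc d)) → Equiv (starAdj d) (centreLabeling d) b ⇔ (components (starAdj d) b % 2 ≡ 1))
    × (Σ (List (Labeling (suc d))) λ reps →
         (length reps ≡ 2 ^ (d ∸ 1) + 1)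
         × AllPairs (λ x y → ¬ Equiv (starAdj d) x y) reps
         × ((a : Labeling (suc d)) → Any (λ r → Equiv (starAdj d) a r) reps))
theorem3p15 d@(suc d-1) (s≤s z≤n) =
    (λ _ → Fixed⇒Equiv-trivial {adj = starAdj d} (Fixed-unlit-even d (replicate d false) (parity-replicate-false d)))
  , (λ { (false ∷ p) refl _ even → unlit-even⇒singleton-class d p even })
  , Equiv-centre⇔components-odd d
  , representatives d
  , length-representatives d-1
  , representatives-inequivalent d
  , representatives-cover d
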